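{- For any labeling scheme for matchings (in the adversarial model described in the context) that uses $m$ possible labels, there is an adversary whose probability of successful forgery is at least $\Omega(1/\sqrt{m})$.
   Context: A matching here is a graph that is a disjoint union of edges. A labeling scheme (adjacency sketch) for a family of graphs consists of a randomized encoder that, given a graph $G$ in the family, outputs a labeling $\ell:V(G)\to L$ into a set $L$ of possible labels, and a deterministic decoder $\mathcal D:L\times L\to\{0,1\}$; the scheme errs only on non-edges, i.e. $\mathcal D(\ell(u),\ell(v))=1$ always holds for edges $(u,v)$. Adversarial game: the adversary chooses $G$ in the family with $n$ vertices; labels are drawn by the encoder; the (computationally unbounded) adversary adaptively requests the labels of vertices $x_1,\dots,x_k$, $k\le n-2$, each choice possibly depending on earlier answers; it then names two distinct vertices $x_{k+1},x_{k+2}$ not previously queried. It wins (forges) if $(x_{k+1},x_{k+2})\notin E(G)$ but $\mathcal D(\ell(x_{k+1}),\ell(x_{k+2}))=1$.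
   Formalization: The randomized encoder has only rational probabilities: on each matching its output is a finitely supported distribution over labelings with rational weights, namely uniform over a nonempty finite multiset of labelings. -}

module Defs where

open import Data.Nat using (ℕ; zero; suc; _+_; _*_; _≤_)
open import Data.Fin using (Fin)
open import Data.Fin.Properties using (_≟_)
open import Data.Bool using (Bool; true; false; not; _∧_)
open import Data.Maybe using (Maybe; just; nothing)
import Data.Maybe.Properties as MaybeP
open import Data.List using (List; []; _∷_; length; filter)
open import Data.List.Membership.Propositional using (_∈_)
open import Data.Product using (Σ; _×_; _,_; ∃-syntax)
open import Relation.Binary.PropositionalEquality using (_≡_; _≢_)
open import Relation.Nullary.Decidable using (Dec; ⌊_⌋)
open import Relation.Unary using (Decidable)
import Data.List.Membership.DecPropositional as DecMem

record Matching (n : ℕ) : Set where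
  field
    partner : Fin n → Maybe (Fin n)
    irrefl  : ∀ x → partner x ≢ just x
    symm    : ∀ x y → partner x ≡ just y → partner y ≡ just x

Edge : ∀ {n} → Matching n → Fin n → Fin n → Set
Edge M x y = Matching.partner M x ≡ just y

edge? : ∀ {n} (M : Matching n) (x y : Fin n) → Dec (Edge M x y)
edge? M x y = MaybeP.≡-dec _≟_ (Matching.partner M x) (just y)

-- The encoder's output distribution on a matching is given
-- as a nonempty finite list of labelings, the distribution being uniform over
-- the list (with multiplicity).
record LabelingScheme (m : ℕ) : Set where
  field
    decode   : Fin m → Fin m → Bool
    encode   : (n : ℕ) → Matching n → List (Fin n → Fin m)
    nonempty : ∀ n (M : Matching n) → encode n M ≢ []
    sound    : ∀ n (M : Matching n) (ℓ : Fin n → Fin m) → ℓ ∈ encode n M →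
               ∀ x y → Edge M x y → decode (ℓ x) (ℓ y) ≡ true

data Strategy (n m : ℕ) : Set where
  output : Fin n → Fin n → Strategy n m
  query  : Fin n → (Fin m → Strategy n m) → Strategy n m

run : ∀ {n m} → Strategy n m → (Fin n → Fin m) → List (Fin n) × Fin n × Fin n
run (output x y) ℓ = [] , x , y
run (query v k) ℓ with run (k (ℓ v)) ℓ
... | qs , x , y = v ∷ qs , x , y

forges : ∀ {n m} → Matching n → (Fin m → Fin m → Bool) → Strategy n m →
         (Fin n → Fin m) → Bool
forges {n} M D A ℓ with run A ℓ
... | qs , x , y =
  not ⌊ x ≟ y ⌋ ∧ not ⌊ x ∈? qs ⌋ ∧ not ⌊ y ∈? qs ⌋ ∧
  not ⌊ edge? M x y ⌋ ∧ D (ℓ x) (ℓ y)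
  where open DecMem {A = Fin n} _≟_ using (_∈?_)

-- Number of labelings in the encoder's output list on which the adversary forges;
-- the forging probability is  forgeCount / length (encode n M).
forgeCount : ∀ {m} (S : LabelingScheme m) (n : ℕ) (M : Matching n) →
             Strategy n m → ℕ
forgeCount S n M A =
  length (filter (λ ℓ → forges M (LabelingScheme.decode S) A ℓ Data.Bool.≟ true)
                 (LabelingScheme.encode S n M))

-- Take k = 2m disjoint edges a_i b_i.  For a labelling ℓ call r twinned if
-- ℓ(a_r) = ℓ(a_j) for some j ≠ r; by pigeonhole at least k - m = m indices are
-- twinned.  The candidates of r are the j ≠ r whose a_j-label the decoder accepts
-- together with the label of b_r.  Guessing the non-edge (a_j, b_r) forges for every
-- candidate j.  Probing b_r and all a_j (j ≠ r) and outputting a_r with the partner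
-- of the s-th candidate forges when that candidate is a twin j of r, because then
-- D(ℓ a_r, ℓ b_j) = D(ℓ a_j, ℓ b_j) = 1.  So for a twinned r either t candidates exist
-- (t guesses forge) or a twin is among the first t candidates (some probe forges).
-- With t ≈ √m and every probe counted t times, each labelling makes at least t·m of
-- the k(t² + k) = O(m t²) strategies forge, and averaging over the encoder's
-- labellings yields one strategy forging with probability Ω(1/t) = Ω(1/√m).
module Submission where

open import Defs
open import Algebra.Properties.CommutativeSemigroup using (interchange)
open import Data.Bool using (Bool; true; not) renaming (_≟_ to _≟ᵇ_)
open import Data.Fin using (Fin; zero; suc; toℕ; fromℕ<; _↑ˡ_; _↑ʳ_; splitAt; join)
open import Data.Fin.Properties
  using (_≟_; any?; injective⇒≤; toℕ-fromℕ<; ↑ˡ-injective; ↑ʳ-injective; splitAt-↑ˡ; splitAt-↑ʳ;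
         splitAt-join; join-splitAt)
open import Data.List
  using (List; []; _∷_; [_]; _++_; map; filter; length; concat; concatMap; replicate; allFin;
         lookup; head; drop)
open import Data.List.Extrema.Nat using (argmax; f[xs]≤f[argmax])
open import Data.List.Membership.Propositional using (_∈_; _∉_; lose)
open import Data.List.Membership.Propositional.Properties
  using (∈-allFin; ∈-filter⁺; ∈-filter⁻; ∈-lookup; ∈-map⁻)
import Data.List.Membership.DecPropositional as DecMembership
open import Data.List.Properties
  using (length-++; length-map; length-tabulate; filter-++; filter-all; filter-some; map-cong)
open import Data.List.Relation.Binary.Sublist.Propositional using (_⊆_; ⊆-trans)
open import Data.List.Relation.Binary.Sublist.Propositional.Properties
  using (filter⁺; filter-⊆; length-mono-≤; map⁺)
open import Data.List.Relation.Unary.All as All using (All)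
import Data.List.Relation.Unary.All.Properties as Allₚ
open import Data.List.Relation.Unary.Any using (here; there)
import Data.List.Relation.Unary.Any.Properties as Anyₚ
open import Data.List.Relation.Unary.Unique.Propositional using (Unique)
import Data.List.Relation.Unary.Unique.Propositional.Properties as Uniqueₚ
open import Data.Maybe using (just; maybe)
open import Data.Maybe.Properties using (just-injective)
open import Data.Nat
  using (ℕ; zero; suc; _+_; _*_; _≤_; _<_; _≤?_; z≤n; s≤s; s≤s⁻¹; NonZero; >-nonZero; >-nonZero⁻¹)
open import Data.Nat.ListAction using (sum)
open import Data.Nat.Properties
  using (≤-trans; ≤-reflexive; ≤-antisym; <-trans; <-≤-trans; ≰⇒>; n≤1+n; m≤m+n; m≤n+m; m≤m*n;
         +-suc; +-mono-≤; +-monoˡ-≤; +-monoʳ-≤; +-cancelʳ-≤; +-commutativeSemigroup; *-identityʳ;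
         *-mono-≤; *-monoˡ-≤; *-monoʳ-≤; *-cancelʳ-≤; m*n≢0; m*n≢0⇒m≢0; module ≤-Reasoning)
open import Data.Nat.Tactic.RingSolver using (solve)
open import Data.Product using (Σ; ∃; ∃-syntax; _×_; _,_; proj₁; proj₂; map₂)
open import Data.Sum using (_⊎_; inj₁; inj₂; swap)
open import Data.Sum.Properties using (swap-involutive)
open import Function using (_∘_; id)
open import Relation.Binary.Core using (REL)
open import Relation.Binary.Definitions using () renaming (Decidable to Decidable₂)
open import Relation.Binary.PropositionalEquality
  using (_≡_; _≢_; refl; sym; trans; cong; cong₂; subst; module ≡-Reasoning)
open import Relation.Nullary using (¬_; Dec; yes; no; ¬?; _×-dec_; ⌊_⌋; contradiction)
open import Relation.Unary using (Pred; Decidable)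

module _ {a} {A : Set a} where

  -- Opened only here: globally these constructors would make the lists passed to `solve` ambiguous.
  open import Data.List.Relation.Unary.All using ([]; _∷_)
  open import Data.List.Relation.Unary.AllPairs using (_∷_)

  sum-map-zero : ∀ (xs : List A) → sum (map (λ _ → 0) xs) ≡ 0
  sum-map-zero []       = refl
  sum-map-zero (_ ∷ xs) = sum-map-zero xs

  sum-map-+ : ∀ (f g : A → ℕ) xs → sum (map (λ x → f x + g x) xs) ≡ sum (map f xs) + sum (map g xs)
  sum-map-+ f g []       = refl
  sum-map-+ f g (x ∷ xs) = trans (cong (f x + g x +_) (sum-map-+ f g xs))
                                 (interchange +-commutativeSemigroup (f x) (g x) _ _)

  length*≤sum : ∀ {f : A → ℕ} {c xs} → All (λ x → c ≤ f x) xs → length xs * c ≤ sum (map f xs)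
  length*≤sum []             = z≤n
  length*≤sum (c≤fx ∷ c≤fxs) = +-mono-≤ c≤fx (length*≤sum c≤fxs)

  sum≤length* : ∀ {f : A → ℕ} {c xs} → All (λ x → f x ≤ c) xs → sum (map f xs) ≤ length xs * c
  sum≤length* []             = z≤n
  sum≤length* (fx≤c ∷ fxs≤c) = +-mono-≤ fx≤c (sum≤length* fxs≤c)

  length-concat-replicate : ∀ n (xs : List A) → length (concat (replicate n xs)) ≡ n * length xs
  length-concat-replicate zero    xs = refl
  length-concat-replicate (suc n) xs =
    trans (length-++ xs) (cong (length xs +_) (length-concat-replicate n xs))

  length-concatMap : ∀ {b} {B : Set b} {f : B → List A} {c} → (∀ x → length (f x) ≡ c) →
                     ∀ xs → length (concatMap f xs) ≡ length xs * c
  length-concatMap         same []       = refl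
  length-concatMap {f = f} same (x ∷ xs) =
    trans (length-++ (f x)) (cong₂ _+_ (same x) (length-concatMap same xs))

  lookup-injective : ∀ {xs : List A} → Unique xs → ∀ i j → lookup xs i ≡ lookup xs j → i ≡ j
  lookup-injective (_   ∷ _) zero    zero    _  = refl
  lookup-injective (x∉ ∷ _) zero    (suc j) eq = contradiction eq (All.lookup x∉ (∈-lookup j))
  lookup-injective (x∉ ∷ _) (suc i) zero    eq = contradiction (sym eq) (All.lookup x∉ (∈-lookup i))
  lookup-injective (_   ∷ u) (suc i) (suc j) eq = cong suc (lookup-injective u i j eq)

  ∈⇒head-drop : ∀ {x : A} {xs} → x ∈ xs → ∃ λ i → i < length xs × head (drop i xs) ≡ just x
  ∈⇒head-drop (here refl)  = 0 , s≤s z≤n , refl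
  ∈⇒head-drop (there x∈xs) with ∈⇒head-drop x∈xs
  ... | i , i<n , eq = suc i , s≤s i<n , eq

length-allFin : ∀ n → length (allFin n) ≡ n
length-allFin n = length-tabulate id

module _ {a b p} {A : Set a} {B : Set b} {P : Pred B p} (P? : Decidable P) where

  filterKeys : List (A × B) → List A
  filterKeys = map proj₁ ∘ filter (P? ∘ proj₂)

  filterKeys-graph : ∀ (g : A → B) xs → filterKeys (map (λ x → x , g x) xs) ≡ filter (P? ∘ g) xs
  filterKeys-graph g []       = refl
  filterKeys-graph g (x ∷ xs) with P? (g x)
  ... | yes _ = cong (x ∷_) (filterKeys-graph g xs)
  ... | no  _ = filterKeys-graph g xs

count : ∀ {a p} {A : Set a} {P : Pred A p} → Decidable P → List A → ℕ
count P? xs = length (filter P? xs)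

module _ {a p} {A : Set a} {P : Pred A p} (P? : Decidable P) where

  count-++ : ∀ xs ys → count P? (xs ++ ys) ≡ count P? xs + count P? ys
  count-++ xs ys = trans (cong length (filter-++ P? xs ys)) (length-++ (filter P? xs))

  count-concat-replicate : ∀ n xs → count P? (concat (replicate n xs)) ≡ n * count P? xs
  count-concat-replicate zero    xs = refl
  count-concat-replicate (suc n) xs =
    trans (count-++ xs _) (cong (count P? xs +_) (count-concat-replicate n xs))

  count+count-complement : ∀ xs → count P? xs + count (¬? ∘ P?) xs ≡ length xs
  count+count-complement []       = refl
  count+count-complement (x ∷ xs) with P? x
  ... | yes _ = cong suc (count+count-complement xs)
  ... | no  _ = trans (+-suc _ _) (cong suc (count+count-complement xs))

  length≤count : ∀ {xs ys} → xs ⊆ ys → All P xs → length xs ≤ count P? ys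
  length≤count {ys = ys} xs⊆ys all-P = subst (_≤ count P? ys) (cong length (filter-all P? all-P))
    (length-mono-≤ (filter⁺ P? P? (λ { refl px → px }) xs⊆ys))

  module _ {b q} {B : Set b} {Q : Pred B q} (Q? : Decidable Q) {f : B → List A} {c : ℕ}
           (bound : ∀ {x} → Q x → c ≤ count P? (f x)) where

    count*≤count-concatMap : ∀ xs → count Q? xs * c ≤ count P? (concatMap f xs)
    count*≤count-concatMap []       = z≤n
    count*≤count-concatMap (x ∷ xs) with Q? x
    ... | yes qx = subst (_ + count Q? xs * c ≤_) (sym (count-++ (f x) _))
                     (+-mono-≤ (bound qx) (count*≤count-concatMap xs))
    ... | no  _  = subst (count Q? xs * c ≤_) (sym (count-++ (f x) _))
                     (≤-trans (count*≤count-concatMap xs) (m≤n+m _ _))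

module _ {a b r} {A : Set a} {B : Set b} {R : REL A B r} (R? : Decidable₂ R) where

  private
    sum-count-singleton : ∀ x ys → sum (map (λ y → count (λ x′ → R? x′ y) [ x ]) ys) ≡ count (R? x) ys
    sum-count-singleton x []       = refl
    sum-count-singleton x (y ∷ ys) with R? x y
    ... | yes _ = cong suc (sum-count-singleton x ys)
    ... | no  _ = sum-count-singleton x ys

  sum-count-comm : ∀ xs ys →
    sum (map (λ y → count (λ x → R? x y) xs) ys) ≡ sum (map (λ x → count (R? x) ys) xs)
  sum-count-comm []       ys = sum-map-zero ys
  sum-count-comm (x ∷ xs) ys = begin
    sum (map (λ y → count (λ x′ → R? x′ y) (x ∷ xs)) ys)
      ≡⟨ cong sum (map-cong (λ y → count-++ (λ x′ → R? x′ y) [ x ] xs) ys) ⟩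
    sum (map (λ y → count (λ x′ → R? x′ y) [ x ] + count (λ x′ → R? x′ y) xs) ys)
      ≡⟨ sum-map-+ _ _ ys ⟩
    sum (map (λ y → count (λ x′ → R? x′ y) [ x ]) ys) + sum (map (λ y → count (λ x′ → R? x′ y) xs) ys)
      ≡⟨ cong₂ _+_ (sum-count-singleton x ys) (sum-count-comm xs ys) ⟩
    count (R? x) ys + sum (map (λ x′ → count (R? x′) ys) xs) ∎
    where open ≡-Reasoning

  -- The default x₀ matters only for an empty xs, where the bound holds trivially.
  averaging : ∀ {c} (x₀ : A) xs ys → All (λ y → c ≤ count (λ x → R? x y) xs) ys →
              ∃ λ x → length ys * c ≤ length xs * count (R? x) ys
  averaging {c} x₀ xs ys bound = best , (begin
    length ys * c                                ≤⟨ length*≤sum bound ⟩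
    sum (map (λ y → count (λ x → R? x y) xs) ys) ≡⟨ sum-count-comm xs ys ⟩
    sum (map (λ x → count (R? x) ys) xs)         ≤⟨ sum≤length* (f[xs]≤f[argmax] x₀ xs) ⟩
    length xs * count (R? best) ys               ∎)
    where
    open ≤-Reasoning
    best : A
    best = argmax (λ x → count (R? x) ys) x₀ xs

module _ {k m} (x : Fin k → Fin m) where

  HasTwin : Pred (Fin k) _
  HasTwin r = ∃ λ j → j ≢ r × x j ≡ x r

  hasTwin? : Decidable HasTwin
  hasTwin? r = any? (λ j → ¬? (j ≟ r) ×-dec (x j ≟ x r))

  count-lonely≤ : count (¬? ∘ hasTwin?) (allFin k) ≤ m
  count-lonely≤ = injective⇒≤ {f = x ∘ lookup lonely} λ {i} {j} eq →
    lookup-injective (Uniqueₚ.filter⁺ _ (Uniqueₚ.allFin⁺ k)) i j (no-twin (isLonely j) eq)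
    where
    lonely : List (Fin k)
    lonely = filter (¬? ∘ hasTwin?) (allFin k)
    isLonely : ∀ i → ¬ HasTwin (lookup lonely i)
    isLonely i = proj₂ (∈-filter⁻ (¬? ∘ hasTwin?) {xs = allFin k} (∈-lookup i))
    no-twin : ∀ {i r} → ¬ HasTwin r → x i ≡ x r → i ≡ r
    no-twin {i} {r} lonely-r eq with i ≟ r
    ... | yes i≡r = i≡r
    ... | no  i≢r = contradiction (i , i≢r , eq) lonely-r

  k≤count-twins+m : k ≤ count hasTwin? (allFin k) + m
  k≤count-twins+m = begin
    k                                                           ≡⟨ length-allFin k ⟨
    length (allFin k)                                           ≡⟨ count+count-complement hasTwin? (allFin k) ⟨
    count hasTwin? (allFin k) + count (¬? ∘ hasTwin?) (allFin k) ≤⟨ +-monoʳ-≤ _ count-lonely≤ ⟩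
    count hasTwin? (allFin k) + m                               ∎
    where open ≤-Reasoning

module Pairing (k : ℕ) where

  a b : Fin k → Fin (k + k)
  a i = i ↑ˡ k
  b i = k ↑ʳ i

  opposite : Fin (k + k) → Fin (k + k)
  opposite = join k k ∘ swap ∘ splitAt k

  opposite-involutive : ∀ v → opposite (opposite v) ≡ v
  opposite-involutive v = begin
    join k k (swap (splitAt k (join k k (swap (splitAt k v)))))
      ≡⟨ cong (join k k ∘ swap) (splitAt-join k k (swap (splitAt k v))) ⟩
    join k k (swap (swap (splitAt k v)))  ≡⟨ cong (join k k) (swap-involutive (splitAt k v)) ⟩
    join k k (splitAt k v)                ≡⟨ join-splitAt k k v ⟩
    v                                     ∎
    where open ≡-Reasoning

  opposite-irrefl : ∀ v → opposite v ≢ v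
  opposite-irrefl v eq =
    swap-≢ (splitAt k v) (trans (sym (splitAt-join k k (swap (splitAt k v)))) (cong (splitAt k) eq))
    where
    swap-≢ : ∀ {A : Set} (s : A ⊎ A) → swap s ≢ s
    swap-≢ (inj₁ _) ()
    swap-≢ (inj₂ _) ()

  matching : Matching (k + k)
  matching = record
    { partner = just ∘ opposite
    ; irrefl  = λ v → opposite-irrefl v ∘ just-injective
    ; symm    = λ { v _ refl → cong just (opposite-involutive v) }
    }

  opposite-a : ∀ i → opposite (a i) ≡ b i
  opposite-a i = cong (join k k ∘ swap) (splitAt-↑ˡ k i k)

  a-b-edge : ∀ i → Edge matching (a i) (b i)
  a-b-edge i = cong just (opposite-a i)

  a-b-edge⁻¹ : ∀ {i j} → Edge matching (a i) (b j) → i ≡ j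
  a-b-edge⁻¹ {i} {j} e = ↑ʳ-injective k i j (trans (sym (opposite-a i)) (just-injective e))

  a≢b : ∀ i j → a i ≢ b j
  a≢b i j eq with trans (sym (splitAt-↑ˡ k i k)) (trans (cong (splitAt k) eq) (splitAt-↑ʳ k k j))
  ... | ()

¬⇒not⌊⌋ : ∀ {p} {P : Set p} (P? : Dec P) → ¬ P → not ⌊ P? ⌋ ≡ true
¬⇒not⌊⌋ (yes p) ¬p = contradiction p ¬p
¬⇒not⌊⌋ (no _)  _  = refl

module _ {n m : ℕ} where

  open DecMembership {A = Fin n} _≟_ using (_∈?_)

  forges-intro : ∀ (M : Matching n) D A (ℓ : Fin n → Fin m) {qs x y} → run A ℓ ≡ (qs , x , y) →
                 x ≢ y → x ∉ qs → y ∉ qs → ¬ Edge M x y → D (ℓ x) (ℓ y) ≡ true →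
                 forges M D A ℓ ≡ true
  forges-intro M D A ℓ {qs} {x} {y} eq x≢y x∉qs y∉qs ¬xy accept with run A ℓ | eq
  ... | _ | refl rewrite ¬⇒not⌊⌋ (x ≟ y) x≢y | ¬⇒not⌊⌋ (x ∈? qs) x∉qs
                       | ¬⇒not⌊⌋ (y ∈? qs) y∉qs | ¬⇒not⌊⌋ (edge? M x y) ¬xy = accept

  module _ {k} {K : Set k} (vertex : K → Fin n) where

    askAll : List K → (List (K × Fin m) → Fin n × Fin n) → Strategy n m
    askAll []       f = output (proj₁ (f [])) (proj₂ (f []))
    askAll (j ∷ js) f = query (vertex j) λ c → askAll js (f ∘ ((j , c) ∷_))

    run-askAll : ∀ js f (ℓ : Fin n → Fin m) →
                 run (askAll js f) ℓ ≡ (map vertex js , f (map (λ j → j , ℓ (vertex j)) js))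
    run-askAll []       f ℓ = refl
    run-askAll (j ∷ js) f ℓ rewrite run-askAll js (f ∘ ((j , ℓ (vertex j)) ∷_)) ℓ = refl

module Attack {m} (D : Fin m → Fin m → Bool) (k t : ℕ) where

  open Pairing k

  decodes? : ∀ c c′ → Dec (D c c′ ≡ true)
  decodes? c c′ = D c c′ ≟ᵇ true

  others : Fin k → List (Fin k)
  others r = filter (λ j → ¬? (j ≟ r)) (allFin k)

  guess : Fin k → Fin k → Strategy (k + k) m
  guess r j = output (a j) (b r)

  -- With at most s candidates the output (a r, a r) never forges.
  pick : Fin k → Fin t → Fin m → List (Fin k × Fin m) → Fin (k + k) × Fin (k + k)
  pick r s c answers = a r , maybe b (a r) (head (drop (toℕ s) (filterKeys (λ c′ → decodes? c′ c) answers)))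

  probe : Fin k → Fin t → Strategy (k + k) m
  probe r s = query (b r) λ c → askAll a (others r) (pick r s c)

  block : Fin k → List (Strategy (k + k) m)
  block r = concat (replicate t (map (probe r) (allFin t))) ++ map (guess r) (allFin k)

  family : List (Strategy (k + k) m)
  family = concatMap block (allFin k)

  length-family : length family ≡ k * (t * t + k)
  length-family = begin
    length family                   ≡⟨ length-concatMap length-block (allFin k) ⟩
    length (allFin k) * (t * t + k) ≡⟨ cong (_* (t * t + k)) (length-allFin k) ⟩
    k * (t * t + k)                 ∎
    where
    open ≡-Reasoning
    length-block : ∀ r → length (block r) ≡ t * t + k
    length-block r = begin
      length (block r)
        ≡⟨ length-++ (concat (replicate t (map (probe r) (allFin t)))) ⟩
      length (concat (replicate t (map (probe r) (allFin t)))) + length (map (guess r) (allFin k))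
        ≡⟨ cong₂ _+_ (length-concat-replicate t _) (length-map (guess r) (allFin k)) ⟩
      t * length (map (probe r) (allFin t)) + length (allFin k)
        ≡⟨ cong₂ (λ x y → t * x + y) (trans (length-map (probe r) (allFin t)) (length-allFin t))
                                     (length-allFin k) ⟩
      t * t + k ∎

  ∈-others⁻ : ∀ {j r} → j ∈ others r → j ≢ r
  ∈-others⁻ {r = r} = proj₂ ∘ ∈-filter⁻ (λ j → ¬? (j ≟ r)) {xs = allFin k}

  a∉probed : ∀ r → a r ∉ b r ∷ map a (others r)
  a∉probed r (here ar≡br) = a≢b r r ar≡br
  a∉probed r (there ar∈) with ∈-map⁻ a ar∈
  ... | j , j∈others , ar≡aj = ∈-others⁻ j∈others (sym (↑ˡ-injective k r j ar≡aj))

  b∉probed : ∀ {j r} → j ≢ r → b j ∉ b r ∷ map a (others r)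
  b∉probed {j} {r} j≢r (here bj≡br) = j≢r (↑ʳ-injective k j r bj≡br)
  b∉probed j≢r (there bj∈) with ∈-map⁻ a bj∈
  ... | i , _ , bj≡ai = a≢b i _ (sym bj≡ai)

  module _ (ℓ : Fin (k + k) → Fin m) where

    Forges : Pred (Strategy (k + k) m) _
    Forges A = forges matching D A ℓ ≡ true

    forges? : Decidable Forges
    forges? A = forges matching D A ℓ ≟ᵇ true

    candidates : Fin k → List (Fin k)
    candidates r = filter (λ j → decodes? (ℓ (a j)) (ℓ (b r))) (others r)

    run-probe : ∀ r s → run (probe r s) ℓ ≡
      (b r ∷ map a (others r) , a r , maybe b (a r) (head (drop (toℕ s) (candidates r))))
    run-probe r s rewrite run-askAll a (others r) (pick r s (ℓ (b r))) ℓ =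
      cong (λ cs → b r ∷ map a (others r) , a r , maybe b (a r) (head (drop (toℕ s) cs)))
           (filterKeys-graph (λ c′ → decodes? c′ (ℓ (b r))) (ℓ ∘ a) (others r))

    guess-forges : ∀ {r j} → j ∈ candidates r → Forges (guess r j)
    guess-forges {r} {j} j∈ with ∈-filter⁻ _ {xs = others r} j∈
    ... | j∈others , accept = forges-intro matching D (guess r j) ℓ refl
          (a≢b j r) (λ ()) (λ ()) (∈-others⁻ j∈others ∘ a-b-edge⁻¹) accept

    module _ (accepts : ∀ i → D (ℓ (a i)) (ℓ (b i)) ≡ true) where

      probe-forges : ∀ {r j} s → j ≢ r → ℓ (a j) ≡ ℓ (a r) →
                     head (drop (toℕ s) (candidates r)) ≡ just j → Forges (probe r s)
      probe-forges {r} {j} s j≢r twin picks-j = forges-intro matching D (probe r s) ℓ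
        (trans (run-probe r s) (cong (λ o → b r ∷ map a (others r) , a r , maybe b (a r) o) picks-j))
        (a≢b r j) (a∉probed r) (b∉probed j≢r) (j≢r ∘ sym ∘ a-b-edge⁻¹)
        (subst (λ c → D c (ℓ (b j)) ≡ true) twin (accepts j))

      count-block : ∀ r → count forges? (block r) ≡
        t * count forges? (map (probe r) (allFin t)) + count forges? (map (guess r) (allFin k))
      count-block r = trans (count-++ forges? (concat (replicate t _)) _)
                            (cong (_+ count forges? (map (guess r) (allFin k)))
                                  (count-concat-replicate forges? t (map (probe r) (allFin t))))

      block-forgeries : ∀ {r} → HasTwin (ℓ ∘ a) r → t ≤ count forges? (block r)
      block-forgeries {r} (j , j≢r , twin) rewrite count-block r with t ≤? length (candidates r)
      ... | yes many = ≤-trans many (≤-trans guesses-forge (m≤n+m _ _))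
        where
        guesses-forge : length (candidates r) ≤ count forges? (map (guess r) (allFin k))
        guesses-forge = subst (_≤ count forges? (map (guess r) (allFin k))) (length-map (guess r) (candidates r))
          (length≤count forges? (map⁺ (guess r) (⊆-trans (filter-⊆ _ (others r)) (filter-⊆ _ (allFin k))))
                                (Allₚ.map⁺ (All.tabulate guess-forges)))
      ... | no few = ≤-trans (≤-reflexive (sym (*-identityʳ t)))
                             (≤-trans (*-monoʳ-≤ t (filter-some forges? (Anyₚ.map⁺ (lose (∈-allFin s) forge))))
                                      (m≤m+n _ _))
        where
        j∈candidates : j ∈ candidates r
        j∈candidates = ∈-filter⁺ _ (∈-filter⁺ _ (∈-allFin j) j≢r)
                         (subst (λ c → D c (ℓ (b r)) ≡ true) (sym twin) (accepts r))
        position : ∃ λ i → i < length (candidates r) × head (drop i (candidates r)) ≡ just j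
        position = ∈⇒head-drop j∈candidates
        i<t : proj₁ position < t
        i<t = <-trans (proj₁ (proj₂ position)) (≰⇒> few)
        s : Fin t
        s = fromℕ< i<t
        forge : Forges (probe r s)
        forge = probe-forges s j≢r twin
          (subst (λ i → head (drop i (candidates r)) ≡ just j) (sym (toℕ-fromℕ< i<t)) (proj₂ (proj₂ position)))

      family-forgeries : count (hasTwin? (ℓ ∘ a)) (allFin k) * t ≤ count forges? family
      family-forgeries = count*≤count-concatMap forges? (hasTwin? (ℓ ∘ a)) block-forgeries (allFin k)

t≤t*t : ∀ t → t ≤ t * t
t≤t*t zero    = z≤n
t≤t*t (suc t) = m≤m*n (suc t) (suc t)

∃-square-between : ∀ m → ∃ λ t → m ≤ t * t × t * t ≤ 4 * m
∃-square-between zero = 0 , z≤n , z≤n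
∃-square-between (suc m) with ∃-square-between m
... | t , m≤t² , t²≤4m with suc m ≤? t * t
...   | yes m<t² = t , m<t² , ≤-trans t²≤4m (*-monoʳ-≤ 4 (n≤1+n m))
...   | no  m≮t² = suc t , lower , upper
  where
  open ≤-Reasoning
  t²≡m : t * t ≡ m
  t²≡m = ≤-antisym (s≤s⁻¹ (≰⇒> m≮t²)) m≤t²
  lower : suc m ≤ suc t * suc t
  lower = s≤s (begin
    m             ≡⟨ t²≡m ⟨
    t * t         ≤⟨ *-monoʳ-≤ t (n≤1+n t) ⟩
    t * suc t     ≤⟨ m≤n+m _ t ⟩
    t + t * suc t ∎)
  upper : suc t * suc t ≤ 4 * suc m
  upper = begin
    suc t * suc t                              ≡⟨ solve (t ∷ []) ⟩
    t * t + (t + t) + 1                        ≤⟨ +-monoˡ-≤ 1 (+-monoʳ-≤ (t * t) (+-mono-≤ (t≤t*t t) (t≤t*t t))) ⟩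
    t * t + (t * t + t * t) + 1                ≤⟨ m≤m+n _ (t * t + 3) ⟩
    t * t + (t * t + t * t) + 1 + (t * t + 3) ≡⟨ solve (t ∷ []) ⟩
    4 * suc (t * t)                            ≡⟨ cong (λ x → 4 * suc x) t²≡m ⟩
    4 * suc m                                  ∎

forging-arithmetic : ∀ m t L F → .{{NonZero m}} → m ≤ t * t → t * t ≤ 4 * m →
                     L * (m * t) ≤ (m + m) * (t * t + (m + m)) * F → L * L ≤ 12 * 12 * m * (F * F)
forging-arithmetic m t L F m≤t² t²≤4m averaged = begin
  L * L                     ≤⟨ *-mono-≤ L≤6tF L≤6tF ⟩
  (6 * t * F) * (6 * t * F) ≡⟨ solve (t ∷ F ∷ []) ⟩
  36 * (t * t) * (F * F)    ≤⟨ *-monoˡ-≤ (F * F) (*-monoʳ-≤ 36 t²≤4m) ⟩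
  36 * (4 * m) * (F * F)    ≡⟨ solve (m ∷ F ∷ []) ⟩
  12 * 12 * m * (F * F)     ∎
  where
  open ≤-Reasoning
  instance
    t≢0 : NonZero t
    t≢0 = m*n≢0⇒m≢0 t {{>-nonZero (<-≤-trans (>-nonZero⁻¹ m) m≤t²)}}
    mt≢0 : NonZero (m * t)
    mt≢0 = m*n≢0 m t
  L≤6tF : L ≤ 6 * t * F
  L≤6tF = *-cancelʳ-≤ L (6 * t * F) (m * t) (begin
    L * (m * t)                             ≤⟨ averaged ⟩
    (m + m) * (t * t + (m + m)) * F
      ≤⟨ *-monoˡ-≤ F (*-monoʳ-≤ (m + m) (+-monoʳ-≤ (t * t) (+-mono-≤ m≤t² m≤t²))) ⟩
    (m + m) * (t * t + (t * t + t * t)) * F ≡⟨ solve (m ∷ t ∷ F ∷ []) ⟩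
    6 * t * F * (m * t)                     ∎)

module _ {m} (S : LabelingScheme m) where

  open LabelingScheme S
  open Pairing (m + m)

  best-forger : ∀ t → Strategy (m + m + (m + m)) m → ∃ λ A →
    length (encode _ matching) * (m * t) ≤ (m + m) * (t * t + (m + m)) * forgeCount S _ matching A
  best-forger t A₀ rewrite sym (Attack.length-family decode (m + m) t) =
    averaging (λ A ℓ → forges matching decode A ℓ ≟ᵇ true) A₀ family (encode _ matching)
              (All.tabulate forgeries)
    where
    open Attack decode (m + m) t
    forgeries : ∀ {ℓ} → ℓ ∈ encode _ matching → m * t ≤ count (forges? ℓ) family
    forgeries {ℓ} ℓ∈L = ≤-trans (*-monoˡ-≤ t (+-cancelʳ-≤ m m _ (k≤count-twins+m (ℓ ∘ a))))
                                (family-forgeries ℓ λ i → sound _ matching ℓ ℓ∈L (a i) (b i) (a-b-edge i))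

  forger : .{{NonZero m}} → Strategy (m + m + (m + m)) m → ∃ λ A →
    length (encode _ matching) * length (encode _ matching)
      ≤ 12 * 12 * m * (forgeCount S _ matching A * forgeCount S _ matching A)
  forger A₀ with ∃-square-between m
  ... | t , m≤t² , t²≤4m = map₂ (λ {A} → forging-arithmetic m t (length (encode _ matching))
                                          (forgeCount S _ matching A) m≤t² t²≤4m)
                               (best-forger t A₀)

theorem2p3 : ∃[ C ] ∃[ m₀ ] (1 ≤ C × (∀ (m : ℕ) → m₀ ≤ m → (S : LabelingScheme m) →
    ∃[ n ] Σ (Matching n) λ M → Σ (Strategy n m) λ A →
      length (LabelingScheme.encode S n M) * length (LabelingScheme.encode S n M)
        ≤ C * C * m * (forgeCount S n M A * forgeCount S n M A)))
theorem2p3 = 12 , 1 , s≤s z≤n , λ where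
  m@(suc _) _ S → _ , Pairing.matching (m + m) , forger S (output zero zero)
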